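{- Let $\ell\ge 2$ be an integer and let $(V^{\sf small},V^{\sf large})$ be an $\alpha$-valuation of the complete bipartite graph $K_{a,b}$, with $|V^{\sf small}|=a$ and $|V^{\sf large}|=b$, such that every element of $V^{\sf large}$ is a multiple of $\ell$ and $V^{\sf small}$ is a union of runs $R_i=\{i\ell,i\ell+1,\dots,i\ell+\ell-1\}$. Let $W^{\sf large}=\{y/\ell: y\in V^{\sf large}\}$, and let $W^{\sf small}$ be the set obtained by replacing each run $R_i=\{i\ell,\dots,i\ell+\ell-1\}\subseteq V^{\sf small}$ by the single element $i$. Then $(W^{\sf small},W^{\sf large})$ is an $\alpha$-valuation of $K_{a/\ell,b}$.
   Context: An $\alpha$-valuation of $K_{a,b}$ is a one-to-one labelling of its vertices by elements of $\{0,1,\dots,ab\}$ such that the absolute differences of endpoint labels over all edges are exactly $\{1,\dots,ab\}$, and there is a value $x$ such that every edge joins a vertex with label $\le x$ to a vertex with label $>x$. Vertices are identified with their labels; $V^{\sf small}$ is the set of labels $\le x$ and $V^{\sf large}$ the set of labels $>x$; equivalently, every element of $V^{\sf large}$ exceeds every element of $V^{\sf small}$ and the differences $u-z$ ($u\in V^{\sf large}$, $z\in V^{\sf small}$) are exactly $1,\dots,ab$, each once. -}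

module Defs where

open import Data.Nat using (ℕ; suc; _+_; _*_; _∸_; _≤_; _<_; NonZero)
open import Data.Nat.DivMod using (_/_)
open import Data.Nat.Divisibility using (_∣_; _∣?_)
open import Data.List using (List; length; map; concatMap; upTo; filter)
open import Data.List.Membership.Propositional using (_∈_)
open import Data.List.Relation.Unary.All using (All)
open import Data.List.Relation.Unary.Unique.Propositional using (Unique)
open import Data.List.Relation.Binary.Permutation.Propositional using (_↭_)
open import Data.Product using (_×_)
open import Relation.Binary.PropositionalEquality using (_≡_)

diffs : List ℕ → List ℕ → List ℕ
diffs large small = concatMap (λ u → map (λ z → u ∸ z) small) large

-- (small , large) is an α-valuation of K_{a,b}: vertices are identified with
-- their (distinct) labels in {0,…,ab}; |small| = a, |large| = b; every large
-- label exceeds every small label; the differences are exactly 1,…,ab, each once.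
IsAlphaValuation : ℕ → ℕ → List ℕ → List ℕ → Set
IsAlphaValuation a b small large =
  Unique small × Unique large ×
  length small ≡ a × length large ≡ b ×
  All (_≤ a * b) small × All (_≤ a * b) large ×
  (∀ {u z} → u ∈ large → z ∈ small → z < u) ×
  (diffs large small ↭ map suc (upTo (a * b)))

UnionOfRuns : (ℓ : ℕ) → .{{_ : NonZero ℓ}} → List ℕ → Set
UnionOfRuns ℓ small =
  ∀ z → z ∈ small → ∀ j → j < ℓ → (z / ℓ) * ℓ + j ∈ small

Wlarge : (ℓ : ℕ) → .{{_ : NonZero ℓ}} → List ℕ → List ℕ
Wlarge ℓ large = map (_/ ℓ) large

-- W^small: each run R_i ⊆ V^small replaced by i; R_i is represented by its
-- unique multiple of ℓ, namely iℓ, so W^small = { z/ℓ : z ∈ V^small, ℓ ∣ z }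
Wsmall : (ℓ : ℕ) → .{{_ : NonZero ℓ}} → List ℕ → List ℕ
Wsmall ℓ small = map (_/ ℓ) (filter (ℓ ∣?_) small)

{-# OPTIONS --safe #-}
module Submission where

-- Since V^small is a union of runs, it is the disjoint union of the runs R_i, i ∈ W^small,
-- so a = ℓ |W^small|, and dividing by ℓ preserves the bounds and the order. For m ≤ ab/ℓ,
-- mℓ = u − z with u ∈ V^large and z ∈ V^small; as ℓ ∣ u also ℓ ∣ z, so m = u/ℓ − z/ℓ is a
-- difference of W. Hence the |W^large| |W^small| = ab/ℓ differences of W cover 1, …, ab/ℓ,
-- and so each occurs exactly once.

open import Defs
open import Data.Nat using (ℕ; suc; _+_; _*_; _∸_; _≤_; _<_; z≤n; s≤s; s≤s⁻¹; NonZero; >-nonZero⁻¹)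
open import Data.Nat.Properties
open import Data.Nat.DivMod
open import Data.Nat.Divisibility using (_∣_; _∣?_; n∣m*n; ∣m+n∣m⇒∣n)
open import Data.List using (List; []; _∷_; _++_; length; map; concatMap; upTo; filter)
open import Data.List.Properties using (length-map; length-++; length-upTo)
open import Data.List.Membership.Propositional using (_∈_; find; lose)
open import Data.List.Membership.Propositional.Properties
  using (∈-∃++; ∈-map⁺; ∈-map⁻; ∈-concatMap⁺; ∈-concatMap⁻; ∈-filter⁺; ∈-filter⁻; ∈-upTo⁺; ∈-upTo⁻)
open import Data.List.Relation.Binary.Subset.Propositional using (_⊆_)
open import Data.List.Relation.Binary.Disjoint.Propositional using (Disjoint)
open import Data.List.Relation.Unary.All as All using (All; []; _∷_)
import Data.List.Relation.Unary.All.Properties as All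
open import Data.List.Relation.Unary.AllPairs as AllPairs using (_∷_)
import Data.List.Relation.Unary.AllPairs.Properties as AllPairs
open import Data.List.Relation.Unary.Any using (here; there)
open import Data.List.Relation.Unary.Unique.Propositional using (Unique)
import Data.List.Relation.Unary.Unique.Propositional.Properties as Unique
open import Data.List.Relation.Binary.Permutation.Propositional using (_↭_; refl; prep; trans; ↭-sym)
open import Data.List.Relation.Binary.Permutation.Propositional.Properties using (∈-resp-↭; ↭-length; shift)
open import Data.Product using (_×_; _,_; ∃-syntax)
open import Data.Empty using (⊥-elim)
open import Relation.Binary.PropositionalEquality
  using (_≡_; _≢_; refl; sym; cong; cong₂; subst; subst₂; module ≡-Reasoning)
  renaming (trans to ≡-trans)

module _ {a} {A : Set a} where

  private
    ∈⇒↭∷ : ∀ {x : A} {ys} → x ∈ ys → ∃[ ys′ ] ys ↭ x ∷ ys′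
    ∈⇒↭∷ {x} x∈ys with as , bs , refl ← ∈-∃++ x∈ys = as ++ bs , shift x as bs

    ⊆-↭∷ : ∀ {x : A} {xs ys ys′} → Unique (x ∷ xs) → x ∷ xs ⊆ ys → ys ↭ x ∷ ys′ → xs ⊆ ys′
    ⊆-↭∷ (x∉xs ∷ _) sub σ y∈xs with ∈-resp-↭ σ (sub (there y∈xs))
    ... | here refl = ⊥-elim (All.lookup x∉xs y∈xs refl)
    ... | there y∈ys′ = y∈ys′

  Unique-⊆⇒length≤ : ∀ {xs ys : List A} → Unique xs → xs ⊆ ys → length xs ≤ length ys
  Unique-⊆⇒length≤ {[]} _ _ = z≤n
  Unique-⊆⇒length≤ {x ∷ xs} u@(_ ∷ u′) sub with ys′ , σ ← ∈⇒↭∷ (sub (here refl)) =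
    subst (suc (length xs) ≤_) (sym (↭-length σ)) (s≤s (Unique-⊆⇒length≤ u′ (⊆-↭∷ u sub σ)))

  Unique-⊆∧length≤⇒↭ : ∀ {xs ys : List A} → Unique ys → ys ⊆ xs → length xs ≤ length ys → xs ↭ ys
  Unique-⊆∧length≤⇒↭ {[]} {[]} _ _ _ = refl
  Unique-⊆∧length≤⇒↭ {_ ∷ _} {[]} _ _ ()
  Unique-⊆∧length≤⇒↭ {xs} {y ∷ ys} u@(_ ∷ u′) sub |xs|≤ with xs′ , σ ← ∈⇒↭∷ (sub (here refl)) =
    trans σ (prep y (Unique-⊆∧length≤⇒↭ u′ (⊆-↭∷ u sub σ) |xs′|≤))
    where
    |xs′|≤ : length xs′ ≤ length ys
    |xs′|≤ = s≤s⁻¹ (subst (_≤ suc (length ys)) (↭-length σ) |xs|≤)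

  module _ {b} {B : Set b} {f : A → List B} where

    Unique-concatMap⁺ : (g : B → A) → (∀ {x y} → y ∈ f x → g y ≡ x) → (∀ x → Unique (f x)) →
                        ∀ {xs} → Unique xs → Unique (concatMap f xs)
    Unique-concatMap⁺ g g∘f≡id uf u =
      Unique.concat⁺ (All.map⁺ (All.tabulate λ {x} _ → uf x)) (AllPairs.map⁺ (AllPairs.map disjoint u))
      where
      disjoint : ∀ {x x′} → x ≢ x′ → Disjoint (f x) (f x′)
      disjoint x≢x′ (y∈fx , y∈fx′) = x≢x′ (≡-trans (sym (g∘f≡id y∈fx)) (g∘f≡id y∈fx′))

    length-concatMap-const : ∀ k → (∀ x → length (f x) ≡ k) →
                             ∀ xs → length (concatMap f xs) ≡ length xs * k
    length-concatMap-const k |f|≡k [] = refl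
    length-concatMap-const k |f|≡k (x ∷ xs) =
      ≡-trans (length-++ (f x)) (cong₂ _+_ (|f|≡k x) (length-concatMap-const k |f|≡k xs))

∈-diffs⁺ : ∀ {large small u z} → u ∈ large → z ∈ small → u ∸ z ∈ diffs large small
∈-diffs⁺ {small = small} u∈large z∈small =
  ∈-concatMap⁺ (λ u → map (u ∸_) small) (lose u∈large (∈-map⁺ _ z∈small))

∈-diffs⁻ : ∀ large small {d} → d ∈ diffs large small →
           ∃[ u ] ∃[ z ] u ∈ large × z ∈ small × d ≡ u ∸ z
∈-diffs⁻ large small d∈
  with u , u∈large , d∈u-small ← find (∈-concatMap⁻ (λ u → map (u ∸_) small) {xs = large} d∈)
  with z , z∈small , refl ← ∈-map⁻ _ d∈u-small = u , z , u∈large , z∈small , refl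

length-diffs : ∀ large small → length (diffs large small) ≡ length large * length small
length-diffs large small = length-concatMap-const (length small) (λ u → length-map (u ∸_) small) large

∈-map-suc-upTo⁺ : ∀ {m n} → 1 ≤ m → m ≤ n → m ∈ map suc (upTo n)
∈-map-suc-upTo⁺ {suc m} _ m<n = ∈-map⁺ suc (∈-upTo⁺ m<n)

Unique-map-suc-upTo : ∀ n → Unique (map suc (upTo n))
Unique-map-suc-upTo n = Unique.map⁺ suc-injective (Unique.upTo⁺ n)

length-map-suc-upTo : ∀ n → length (map suc (upTo n)) ≡ n
length-map-suc-upTo n = ≡-trans (length-map suc (upTo n)) (length-upTo n)

module _ (ℓ : ℕ) .{{_ : NonZero ℓ}} where

  open ≡-Reasoning

  run : ℕ → List ℕ
  run i = map (i * ℓ +_) (upTo ℓ)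

  [i*ℓ+j]/ℓ≡i : ∀ i {j} → j < ℓ → (i * ℓ + j) / ℓ ≡ i
  [i*ℓ+j]/ℓ≡i i {j} j<ℓ = begin
    (i * ℓ + j) / ℓ     ≡⟨ +-distrib-/-∣ˡ j (n∣m*n i) ⟩
    i * ℓ / ℓ + j / ℓ   ≡⟨ cong₂ _+_ (m*n/n≡m i ℓ) (m<n⇒m/n≡0 j<ℓ) ⟩
    i + 0               ≡⟨ +-identityʳ i ⟩
    i                   ∎

  ∈-run⇒/≡ : ∀ {i y} → y ∈ run i → y / ℓ ≡ i
  ∈-run⇒/≡ {i} y∈run with j , j∈ , refl ← ∈-map⁻ (i * ℓ +_) y∈run = [i*ℓ+j]/ℓ≡i i (∈-upTo⁻ j∈)

  ∈-run-/ : ∀ z → z ∈ run (z / ℓ)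
  ∈-run-/ z = subst (_∈ run (z / ℓ)) z/ℓ*ℓ+z%ℓ≡z (∈-map⁺ _ (∈-upTo⁺ (m%n<n z ℓ)))
    where
    z/ℓ*ℓ+z%ℓ≡z : z / ℓ * ℓ + z % ℓ ≡ z
    z/ℓ*ℓ+z%ℓ≡z = ≡-trans (+-comm (z / ℓ * ℓ) (z % ℓ)) (sym (m≡m%n+[m/n]*n z ℓ))

  Unique-run : ∀ i → Unique (run i)
  Unique-run i = Unique.map⁺ (+-cancelˡ-≡ (i * ℓ) _ _) (Unique.upTo⁺ ℓ)

  length-run : ∀ i → length (run i) ≡ ℓ
  length-run i = ≡-trans (length-map _ (upTo ℓ)) (length-upTo ℓ)

  map-*-map-/ : ∀ {xs} → All (ℓ ∣_) xs → map (_* ℓ) (map (_/ ℓ) xs) ≡ xs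
  map-*-map-/ [] = refl
  map-*-map-/ (ℓ∣x ∷ ℓ∣xs) = cong₂ _∷_ (m/n*n≡m ℓ∣x) (map-*-map-/ ℓ∣xs)

  Unique-map-/ : ∀ {xs} → All (ℓ ∣_) xs → Unique xs → Unique (map (_/ ℓ) xs)
  Unique-map-/ ℓ∣xs u = Unique.map⁻ (subst Unique (sym (map-*-map-/ ℓ∣xs)) u)

  All-≤-map-/ : ∀ {m xs} → All (_≤ m * ℓ) xs → All (_≤ m) (map (_/ ℓ) xs)
  All-≤-map-/ {m} xs≤ = All.map⁺ (All.map (λ x≤ → subst (_ ≤_) (m*n/n≡m m ℓ) (/-monoˡ-≤ ℓ x≤)) xs≤)

  /-mono-<-∣ : ∀ {z u} → ℓ ∣ z → ℓ ∣ u → z < u → z / ℓ < u / ℓ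
  /-mono-<-∣ ℓ∣z ℓ∣u z<u = *-cancelʳ-< ℓ _ _ (subst₂ _<_ (sym (m/n*n≡m ℓ∣z)) (sym (m/n*n≡m ℓ∣u)) z<u)

  ∸-/-∣ : ∀ {u z m} → ℓ ∣ u → z ≤ u → u ∸ z ≡ m * ℓ → ℓ ∣ z × u / ℓ ∸ z / ℓ ≡ m
  ∸-/-∣ {u} {z} {m} ℓ∣u z≤u u∸z≡mℓ = ℓ∣z , *-cancelʳ-≡ _ m ℓ (begin
    (u / ℓ ∸ z / ℓ) * ℓ     ≡⟨ *-distribʳ-∸ ℓ (u / ℓ) (z / ℓ) ⟩
    u / ℓ * ℓ ∸ z / ℓ * ℓ   ≡⟨ cong₂ _∸_ (m/n*n≡m ℓ∣u) (m/n*n≡m ℓ∣z) ⟩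
    u ∸ z                   ≡⟨ u∸z≡mℓ ⟩
    m * ℓ                   ∎)
    where
    ℓ∣z : ℓ ∣ z
    ℓ∣z = ∣m+n∣m⇒∣n (subst (ℓ ∣_) (sym (m∸n+n≡m z≤u)) ℓ∣u) (subst (ℓ ∣_) (sym u∸z≡mℓ) (n∣m*n m))

  ∈-Wsmall⁺ : ∀ {small z} → z ∈ small → ℓ ∣ z → z / ℓ ∈ Wsmall ℓ small
  ∈-Wsmall⁺ z∈small ℓ∣z = ∈-map⁺ (_/ ℓ) (∈-filter⁺ (ℓ ∣?_) z∈small ℓ∣z)

  ∈-Wsmall⁻ : ∀ {small i} → i ∈ Wsmall ℓ small → ∃[ z ] z ∈ small × ℓ ∣ z × i ≡ z / ℓ
  ∈-Wsmall⁻ {small} i∈W with z , z∈ , refl ← ∈-map⁻ (_/ ℓ) i∈W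
    with z∈small , ℓ∣z ← ∈-filter⁻ (ℓ ∣?_) {xs = small} z∈ = z , z∈small , ℓ∣z , refl

  Unique-Wsmall : ∀ {small} → Unique small → Unique (Wsmall ℓ small)
  Unique-Wsmall {small} u = Unique-map-/ (All.all-filter (ℓ ∣?_) small) (Unique.filter⁺ (ℓ ∣?_) u)

  module _ {small} (runs : UnionOfRuns ℓ small) where

    runs-⊆ : concatMap run (Wsmall ℓ small) ⊆ small
    runs-⊆ y∈runs
      with i , i∈W , y∈run ← find (∈-concatMap⁻ run {xs = Wsmall ℓ small} y∈runs)
      with z , z∈small , _ , refl ← ∈-Wsmall⁻ {small} i∈W
      with j , j∈ , refl ← ∈-map⁻ _ y∈run = runs z z∈small j (∈-upTo⁻ j∈)

    ⊆-runs : small ⊆ concatMap run (Wsmall ℓ small)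
    ⊆-runs {z} z∈small = ∈-concatMap⁺ run (lose i∈W (∈-run-/ z))
      where
      i = z / ℓ
      0<ℓ = >-nonZero⁻¹ ℓ
      i∈W : i ∈ Wsmall ℓ small
      i∈W = subst (_∈ Wsmall ℓ small) ([i*ℓ+j]/ℓ≡i i 0<ℓ)
        (∈-Wsmall⁺ (runs z z∈small 0 0<ℓ) (subst (ℓ ∣_) (sym (+-identityʳ (i * ℓ))) (n∣m*n i)))

    length-UnionOfRuns : Unique small → length small ≡ length (Wsmall ℓ small) * ℓ
    length-UnionOfRuns u = ≤-antisym
      (subst (length small ≤_) |runs|≡ (Unique-⊆⇒length≤ u ⊆-runs))
      (subst (_≤ length small) |runs|≡ (Unique-⊆⇒length≤ uruns runs-⊆))
      where
      |runs|≡ : length (concatMap run (Wsmall ℓ small)) ≡ length (Wsmall ℓ small) * ℓ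
      |runs|≡ = length-concatMap-const ℓ length-run (Wsmall ℓ small)
      uruns : Unique (concatMap run (Wsmall ℓ small))
      uruns = Unique-concatMap⁺ (_/ ℓ) ∈-run⇒/≡ Unique-run (Unique-Wsmall u)

  diffs-/-↭ : ∀ {small large m} → All (ℓ ∣_) large → (∀ {u z} → u ∈ large → z ∈ small → z < u) →
              diffs large small ↭ map suc (upTo (m * ℓ)) →
              length large * length (Wsmall ℓ small) ≡ m →
              diffs (Wlarge ℓ large) (Wsmall ℓ small) ↭ map suc (upTo m)
  diffs-/-↭ {small} {large} {m} ℓ∣large small<large diffs↭ |L|*|W|≡m =
    Unique-⊆∧length≤⇒↭ (Unique-map-suc-upTo m) covered
      (≤-reflexive (≡-trans |diffsW|≡m (sym (length-map-suc-upTo m))))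
    where
    |diffsW|≡m : length (diffs (Wlarge ℓ large) (Wsmall ℓ small)) ≡ m
    |diffsW|≡m = begin
      length (diffs (Wlarge ℓ large) (Wsmall ℓ small))   ≡⟨ length-diffs (Wlarge ℓ large) _ ⟩
      length (Wlarge ℓ large) * length (Wsmall ℓ small)  ≡⟨ cong (_* _) (length-map (_/ ℓ) large) ⟩
      length large * length (Wsmall ℓ small)             ≡⟨ |L|*|W|≡m ⟩
      m                                                  ∎

    scaled : ∀ {d} → d ∈ map suc (upTo m) → d * ℓ ∈ map suc (upTo (m * ℓ))
    scaled d∈ with k , k∈ , refl ← ∈-map⁻ suc d∈ =
      ∈-map-suc-upTo⁺ (≤-trans (>-nonZero⁻¹ ℓ) (m≤m+n ℓ (k * ℓ))) (*-monoˡ-≤ ℓ (∈-upTo⁻ k∈))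

    covered : map suc (upTo m) ⊆ diffs (Wlarge ℓ large) (Wsmall ℓ small)
    covered d∈
      with u , z , u∈L , z∈S , dℓ≡u∸z ← ∈-diffs⁻ large small (∈-resp-↭ (↭-sym diffs↭) (scaled d∈))
      with ℓ∣z , u/ℓ∸z/ℓ≡d ← ∸-/-∣ (All.lookup ℓ∣large u∈L) (<⇒≤ (small<large u∈L z∈S)) (sym dℓ≡u∸z)
      = subst (_∈ diffs (Wlarge ℓ large) (Wsmall ℓ small)) u/ℓ∸z/ℓ≡d
              (∈-diffs⁺ (∈-map⁺ (_/ ℓ) u∈L) (∈-Wsmall⁺ z∈S ℓ∣z))

  IsAlphaValuation-/ : ∀ {n b small large} → All (ℓ ∣_) large → UnionOfRuns ℓ small →
                       IsAlphaValuation (n * ℓ) b small large →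
                       IsAlphaValuation n b (Wsmall ℓ small) (Wlarge ℓ large)
  IsAlphaValuation-/ {n} {b} {small} {large} ℓ∣large runs
                     (uS , uL , |S|≡nℓ , |L|≡b , S≤ , L≤ , S<L , diffs↭) =
    Unique-Wsmall uS , Unique-map-/ ℓ∣large uL , |W|≡n , ≡-trans (length-map _ large) |L|≡b ,
    All-≤-map-/ (All.filter⁺ (ℓ ∣?_) (rebound S≤)) , All-≤-map-/ (rebound L≤) , Wsmall<Wlarge ,
    diffs-/-↭ ℓ∣large S<L (subst (λ k → diffs large small ↭ map suc (upTo k)) nℓb≡nbℓ diffs↭)
              (≡-trans (cong₂ _*_ |L|≡b |W|≡n) (*-comm b n))
    where
    |W|≡n : length (Wsmall ℓ small) ≡ n
    |W|≡n = *-cancelʳ-≡ _ n ℓ (≡-trans (sym (length-UnionOfRuns runs uS)) |S|≡nℓ)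

    nℓb≡nbℓ : n * ℓ * b ≡ n * b * ℓ
    nℓb≡nbℓ = begin
      n * ℓ * b     ≡⟨ *-assoc n ℓ b ⟩
      n * (ℓ * b)   ≡⟨ cong (n *_) (*-comm ℓ b) ⟩
      n * (b * ℓ)   ≡⟨ *-assoc n b ℓ ⟨
      n * b * ℓ     ∎

    rebound : ∀ {xs} → All (_≤ n * ℓ * b) xs → All (_≤ n * b * ℓ) xs
    rebound {xs} = subst (λ k → All (_≤ k) xs) nℓb≡nbℓ

    Wsmall<Wlarge : ∀ {v i} → v ∈ Wlarge ℓ large → i ∈ Wsmall ℓ small → i < v
    Wsmall<Wlarge v∈ i∈
      with u , u∈L , refl ← ∈-map⁻ (_/ ℓ) v∈
      with z , z∈S , ℓ∣z , refl ← ∈-Wsmall⁻ {small} i∈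
      = /-mono-<-∣ ℓ∣z (All.lookup ℓ∣large u∈L) (S<L u∈L z∈S)

theorem2p11 : (ℓ : ℕ) → .{{_ : NonZero ℓ}} → 2 ≤ ℓ →
    (a b : ℕ) (small large : List ℕ) →
    IsAlphaValuation a b small large →
    All (ℓ ∣_) large →
    UnionOfRuns ℓ small →
    IsAlphaValuation (a / ℓ) b (Wsmall ℓ small) (Wlarge ℓ large)
theorem2p11 ℓ _ a b small large av@(uS , _ , |S|≡a , _) ℓ∣large runs =
  subst (λ k → IsAlphaValuation k b (Wsmall ℓ small) (Wlarge ℓ large)) (sym a/ℓ≡|W|)
    (IsAlphaValuation-/ ℓ ℓ∣large runs (subst (λ k → IsAlphaValuation k b small large) a≡|W|*ℓ av))
  where
  a≡|W|*ℓ : a ≡ length (Wsmall ℓ small) * ℓ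
  a≡|W|*ℓ = ≡-trans (sym |S|≡a) (length-UnionOfRuns ℓ runs uS)

  a/ℓ≡|W| : a / ℓ ≡ length (Wsmall ℓ small)
  a/ℓ≡|W| = ≡-trans (cong (_/ ℓ) a≡|W|*ℓ) (m*n/n≡m _ ℓ)
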